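{- Let $P$ be the polygon whose vertices, in cyclic order, are $p_0=(0,0)$, $p_1=(1,5)$, $p_2=(0,8)$, $p_3=(2,4)$, $p_4=(6,11)$, $p_5=(4,7)$, $p_6=(15,-1)$, $p_7=(9,3)$, $p_8=(6,4)$. Then $P$ is a simple nonagon such that for each $s\in\{0,1,2\}$, the guards placed at the three vertices $p_s,p_{s+3},p_{s+6}$ do not see all of $P$. In other words, placing guards at every third vertex of $P$ fails to guard $P$ for every choice of starting vertex.
   Context: A polygon is a closed region of the plane bounded by a simple closed polygonal curve. A guard at a point $p$ of a polygon $P$ sees a point $q\in P$ if and only if the line segment $\overline{pq}$ is contained in $P$. A set of guards guards (covers) $P$ if every point of $P$ is seen by at least one of the guards.
   Formalization: Points of the plane, including the points of P, the points of segments checked for visibility and the points excluded by simplicity, are taken in ℚ². -}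

module Defs where

open import Data.Bool using (Bool; true; false; _xor_; _∧_; if_then_else_)
open import Data.Nat as ℕ using (ℕ; suc)
open import Data.Nat.DivMod using (m%n<n)

open import Data.Integer as ℤ using (ℤ; +_; -[1+_])
open import Data.Rational using (ℚ; _/_; _+_; _-_; _*_; _≤_; _<_; 0ℚ; 1ℚ)
open import Data.Rational.Properties using (_<?_; _≤?_)
open import Data.Fin as Fin using (Fin; zero; suc; toℕ)
open import Data.Fin.Properties using ()
open import Data.Product using (_×_; _,_; proj₁; proj₂; ∃)
open import Data.Sum using (_⊎_)
open import Relation.Nullary using (¬_)
open import Relation.Nullary.Decidable using (⌊_⌋)
open import Relation.Binary.PropositionalEquality using (_≡_; _≢_)

Point : Set
Point = ℚ × ℚ

px py : Point → ℚ
px = proj₁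
py = proj₂

pt : ℤ → ℤ → Point
pt a b = (a / 1 , b / 1)

lerp : Point → Point → ℚ → Point
lerp p q t = (px p + t * (px q - px p) , py p + t * (py q - py p))

OnSeg : Point → Point → Point → Set
OnSeg a b q = ∃ λ (t : ℚ) → (0ℚ ≤ t) × (t ≤ 1ℚ) × (q ≡ lerp a b t)

-- orientation (twice signed area) of triangle a b c
orient : Point → Point → Point → ℚ
orient a b c = (px b - px a) * (py c - py a) - (py b - py a) * (px c - px a)

next : ∀ {n} → Fin (suc n) → Fin (suc n)
next {n} i = Fin.fromℕ< (m%n<n (suc (toℕ i)) (suc n))

Polygon : ℕ → Set
Polygon n = Fin (suc n) → Point

OnEdge : ∀ {n} → Polygon n → Fin (suc n) → Point → Set
OnEdge {n} v i q = OnSeg (v i) (v (next i)) q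

OnBoundary : ∀ {n} → Polygon n → Point → Set
OnBoundary v q = ∃ λ i → OnEdge v i q

IsSimple : ∀ {n} → Polygon n → Set
IsSimple {n} v =
  (∀ i j → i ≢ j → v i ≢ v j) ×
  (∀ i j → i ≢ j → next i ≢ j → next j ≢ i →
     ∀ q → ¬ (OnEdge v i q × OnEdge v j q)) ×
  (∀ i q → OnEdge v i q → OnEdge v (next i) q → q ≡ v (next i))

-- Does edge (a,b) cross the horizontal ray {(x, py q) : x > px q}?
-- (standard half-open even–odd crossing rule)
crosses : Point → Point → Point → Bool
crosses a b q =
  if ⌊ py q <? py a ⌋ xor ⌊ py q <? py b ⌋
  then (if ⌊ py q <? py b ⌋
        then ⌊ 0ℚ <? orient a b q ⌋     -- upward edge: q strictly left
        else ⌊ orient a b q <? 0ℚ ⌋)    -- downward edge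
  else false

Odd : ℕ → Set
Odd k = k ℕ.% 2 ≡ 1

b2n : Bool → ℕ
b2n true = 1
b2n false = 0

sumFin : ∀ n → (Fin n → ℕ) → ℕ
sumFin ℕ.zero f = 0
sumFin (suc n) f = f zero ℕ.+ sumFin n (λ i → f (suc i))

crossingNumber : ∀ {n} → Polygon n → Point → ℕ
crossingNumber {n} v q = sumFin (suc n) (λ i → b2n (crosses (v i) (v (next i)) q))

-- The closed region bounded by the (simple) polygonal curve:
-- its boundary together with its interior (even–odd rule).
_∈P_ : ∀ {n} → Point → Polygon n → Set
q ∈P v = OnBoundary v q ⊎ Odd (crossingNumber v q)

Sees : ∀ {n} → Polygon n → Point → Point → Set
Sees v p q = ∀ (t : ℚ) → 0ℚ ≤ t → t ≤ 1ℚ → lerp p q t ∈P v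

Guards : ∀ {n k} → Polygon n → (Fin k → Point) → Set
Guards v g = ∀ q → q ∈P v → ∃ λ j → Sees v (g j) q

nonagon : Polygon 8
nonagon zero = pt (+ 0) (+ 0)
nonagon (suc zero) = pt (+ 1) (+ 5)
nonagon (suc (suc zero)) = pt (+ 0) (+ 8)
nonagon (suc (suc (suc zero))) = pt (+ 2) (+ 4)
nonagon (suc (suc (suc (suc zero)))) = pt (+ 6) (+ 11)
nonagon (suc (suc (suc (suc (suc zero))))) = pt (+ 4) (+ 7)
nonagon (suc (suc (suc (suc (suc (suc zero)))))) = pt (+ 15) -[1+ 0 ]
nonagon (suc (suc (suc (suc (suc (suc (suc zero))))))) = pt (+ 9) (+ 3)
nonagon (suc (suc (suc (suc (suc (suc (suc (suc zero)))))))) = pt (+ 6) (+ 4)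

every3rd : Fin 3 → Fin 3 → Fin 9
every3rd s m = Fin.fromℕ< (m%n<n (toℕ s ℕ.+ 3 ℕ.* toℕ m) 9)

{-# OPTIONS --safe #-}

-- Everything reduces to signs of orientation determinants of rational points, evaluated exactly by
-- decision procedures; the one geometric fact used is that orient a b is affine along any segment.
-- Simplicity: of any two non-adjacent edges, one lies strictly on one side of the other's supporting
-- line, and no three consecutive vertices are collinear, so adjacent edges meet only at their common
-- vertex. Guarding: for each s there is a point q_s of P (odd crossing number) such that the segment
-- from each of p_s, p_{s+3}, p_{s+6} to q_s passes through a point strictly outside P (off every edge
-- line, even crossing number), so none of the three guards sees q_s.
module Submission where

open import Data.Fin using (Fin; zero; suc; _≟_)
open import Data.Fin.Properties using (all?)
open import Data.Integer using (+_)
import Data.Nat as ℕ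
open import Data.Product using (_×_; _,_)
open import Data.Product.Properties using (≡-dec)
open import Data.Rational
  using (ℚ; _/_; _+_; _-_; -_; _*_; _<_; _≤_; 0ℚ; 1ℚ; 1/_; NonZero; Positive; NonNegative;
         ≢-nonZero; positive; nonNegative)
open import Data.Rational.Properties
  using (_<?_; _≤?_; ≤-antisym; ≮⇒≥; <-irrefl; *-identityʳ; *-inverseʳ; *-assoc; *-zeroˡ; *-zeroʳ;
         +-inverseʳ; +-monoˡ-<; +-mono-<-≤; <⇒≤; positive⁻¹; nonNegative⁻¹; pos*pos⇒pos; nonNeg*nonNeg⇒nonNeg)
  renaming (_≟_ to _≟ℚ_)
open import Data.Rational.Solver using (module +-*-Solver)
open import Data.Sum using (_⊎_; inj₁; inj₂)
open import Relation.Binary.PropositionalEquality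
  using (_≡_; _≢_; refl; sym; trans; cong; cong₂; subst; module ≡-Reasoning)
open import Relation.Nullary using (¬_; Dec; yes; no)
open import Relation.Nullary.Decidable using (¬?; _×-dec_; _⊎-dec_; _→-dec_; from-yes)

open import Defs

open +-*-Solver using (Polynomial; solve; _:=_; _:+_; _:*_; _:-_; :-_; con)

private
  variable
    x y t : ℚ
    q r : Point

x*y≡0⇒x≡0 : y ≢ 0ℚ → x * y ≡ 0ℚ → x ≡ 0ℚ
x*y≡0⇒x≡0 {y = y} {x = x} y≢0 xy≡0 = begin
  x              ≡⟨ sym (*-identityʳ x) ⟩
  x * 1ℚ         ≡⟨ cong (x *_) (sym (*-inverseʳ y)) ⟩
  x * (y * 1/ y) ≡⟨ sym (*-assoc x y (1/ y)) ⟩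
  x * y * 1/ y   ≡⟨ cong (_* 1/ y) xy≡0 ⟩
  0ℚ * 1/ y      ≡⟨ *-zeroˡ (1/ y) ⟩
  0ℚ             ∎
  where
  open ≡-Reasoning
  instance
    y-nonZero : NonZero y
    y-nonZero = ≢-nonZero y≢0

interpolate-convex : ∀ x y t → x + t * (y - x) ≡ (1ℚ - t) * x + t * y
interpolate-convex = solve 3 (λ x y t → x :+ t :* (y :- x) := (con 1ℚ :- t) :* x :+ t :* y) refl

interpolate-1 : ∀ x y → x + 1ℚ * (y - x) ≡ y
interpolate-1 = solve 2 (λ x y → x :+ con 1ℚ :* (y :- x) := y) refl

interpolate-pos : 0ℚ < x → 0ℚ < y → 0ℚ ≤ t → t ≤ 1ℚ → 0ℚ < x + t * (y - x)
interpolate-pos {x} {y} {t} 0<x 0<y 0≤t t≤1 with t <? 1ℚ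
... | yes t<1 = subst (0ℚ <_) (sym (interpolate-convex x y t)) (+-mono-<-≤ 0<[1-t]x 0≤ty)
  where
  instance
    1-t-pos : Positive (1ℚ - t)
    1-t-pos = positive (subst (_< 1ℚ - t) (+-inverseʳ t) (+-monoˡ-< (- t) t<1))
    x-pos : Positive x
    x-pos = positive 0<x
    t-nonNeg : NonNegative t
    t-nonNeg = nonNegative 0≤t
    y-nonNeg : NonNegative y
    y-nonNeg = nonNegative (<⇒≤ 0<y)
  0<[1-t]x : 0ℚ < (1ℚ - t) * x
  0<[1-t]x = positive⁻¹ _ {{pos*pos⇒pos (1ℚ - t) x}}
  0≤ty : 0ℚ ≤ t * y
  0≤ty = nonNegative⁻¹ _ {{nonNeg*nonNeg⇒nonNeg t y}}
... | no t≮1 rewrite ≤-antisym t≤1 (≮⇒≥ t≮1) = subst (0ℚ <_) (sym (interpolate-1 x y)) 0<y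

interpolate-root : x ≢ 0ℚ → x + t * (0ℚ - x) ≡ 0ℚ → t ≡ 1ℚ
interpolate-root {x = x} {t = t} x≢0 root = begin
  t              ≡⟨ solve 1 (λ t → t := con 1ℚ :- (con 1ℚ :- t)) refl t ⟩
  1ℚ - (1ℚ - t)  ≡⟨ cong (λ z → 1ℚ - z) (x*y≡0⇒x≡0 {x = 1ℚ - t} x≢0 (trans factor root)) ⟩
  1ℚ - 0ℚ        ∎
  where
  open ≡-Reasoning
  factor : (1ℚ - t) * x ≡ x + t * (0ℚ - x)
  factor = solve 2 (λ x t → (con 1ℚ :- t) :* x := x :+ t :* (con 0ℚ :- x)) refl x t

orient-lerp : ∀ a b c d t → orient a b (lerp c d t) ≡ orient a b c + t * (orient a b d - orient a b c)
orient-lerp (ax , ay) (bx , by) (cx , cy) (dx , dy) =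
  solve 9 (λ ax ay bx by cx cy dx dy t →
      O ax ay bx by (cx :+ t :* (dx :- cx)) (cy :+ t :* (dy :- cy))
        := O ax ay bx by cx cy :+ t :* (O ax ay bx by dx dy :- O ax ay bx by cx cy))
    refl ax ay bx by cx cy dx dy
  where
  O : ∀ {n} → (_ _ _ _ _ _ : Polynomial n) → Polynomial n
  O ax ay bx by cx cy = (bx :- ax) :* (cy :- ay) :- (by :- ay) :* (cx :- ax)

orient[a,b,a]≡0 : ∀ a b → orient a b a ≡ 0ℚ
orient[a,b,a]≡0 (ax , ay) (bx , by) =
  solve 4 (λ ax ay bx by → (bx :- ax) :* (ay :- ay) :- (by :- ay) :* (ax :- ax) := con 0ℚ)
    refl ax ay bx by

orient[a,b,b]≡0 : ∀ a b → orient a b b ≡ 0ℚ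
orient[a,b,b]≡0 (ax , ay) (bx , by) =
  solve 4 (λ ax ay bx by → (bx :- ax) :* (by :- ay) :- (by :- ay) :* (bx :- ax) := con 0ℚ)
    refl ax ay bx by

orient-antisym : ∀ a b c → orient b a c ≡ - orient a b c
orient-antisym (ax , ay) (bx , by) (cx , cy) =
  solve 6 (λ ax ay bx by cx cy →
      (ax :- bx) :* (cy :- by) :- (ay :- by) :* (cx :- bx)
        := :- ((bx :- ax) :* (cy :- ay) :- (by :- ay) :* (cx :- ax)))
    refl ax ay bx by cx cy

lerp-1 : ∀ a b → lerp a b 1ℚ ≡ b
lerp-1 (ax , ay) (bx , by) = cong₂ _,_ (interpolate-1 ax bx) (interpolate-1 ay by)

onSeg⇒orient≡0 : ∀ a b → OnSeg a b q → orient a b q ≡ 0ℚ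
onSeg⇒orient≡0 a b (t , _ , _ , refl) = begin
  orient a b (lerp a b t)                          ≡⟨ orient-lerp a b a b t ⟩
  orient a b a + t * (orient a b b - orient a b a) ≡⟨ cong₂ (λ u v → u + t * (v - u))
                                                            (orient[a,b,a]≡0 a b) (orient[a,b,b]≡0 a b) ⟩
  0ℚ + t * 0ℚ                                      ≡⟨ cong (λ z → 0ℚ + z) (*-zeroʳ t) ⟩
  0ℚ                                               ∎
  where open ≡-Reasoning

onSeg⇒reverse-orient≡0 : ∀ a b → OnSeg a b q → orient b a q ≡ 0ℚ
onSeg⇒reverse-orient≡0 {q = q} a b q∈ab =
  trans (orient-antisym a b q) (cong -_ (onSeg⇒orient≡0 a b q∈ab))

orient≢0⇒¬onSeg : ∀ a b → orient a b q ≢ 0ℚ → ¬ OnSeg a b q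
orient≢0⇒¬onSeg a b off-line q∈ab = off-line (onSeg⇒orient≡0 a b q∈ab)

LeftOf : Point → Point → Point → Point → Set
LeftOf a b c d = 0ℚ < orient a b c × 0ℚ < orient a b d

leftOf? : ∀ a b c d → Dec (LeftOf a b c d)
leftOf? a b c d = 0ℚ <? orient a b c ×-dec 0ℚ <? orient a b d

leftOf⇒orient-pos : ∀ a b c d → LeftOf a b c d → OnSeg c d q → 0ℚ < orient a b q
leftOf⇒orient-pos a b c d (0<c , 0<d) (t , 0≤t , t≤1 , refl) =
  subst (0ℚ <_) (sym (orient-lerp a b c d t)) (interpolate-pos 0<c 0<d 0≤t t≤1)

Apart : Point → Point → Point → Point → Set
Apart a b c d = LeftOf a b c d ⊎ LeftOf b a c d ⊎ LeftOf c d a b ⊎ LeftOf d c a b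

apart? : ∀ a b c d → Dec (Apart a b c d)
apart? a b c d = leftOf? a b c d ⊎-dec leftOf? b a c d ⊎-dec leftOf? c d a b ⊎-dec leftOf? d c a b

apart⇒disjoint : ∀ a b c d → Apart a b c d → ¬ (OnSeg a b q × OnSeg c d q)
apart⇒disjoint a b c d (inj₁ cd-left) (q∈ab , q∈cd) =
  <-irrefl (sym (onSeg⇒orient≡0 a b q∈ab)) (leftOf⇒orient-pos a b c d cd-left q∈cd)
apart⇒disjoint a b c d (inj₂ (inj₁ cd-right)) (q∈ab , q∈cd) =
  <-irrefl (sym (onSeg⇒reverse-orient≡0 a b q∈ab)) (leftOf⇒orient-pos b a c d cd-right q∈cd)
apart⇒disjoint a b c d (inj₂ (inj₂ (inj₁ ab-left))) (q∈ab , q∈cd) =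
  <-irrefl (sym (onSeg⇒orient≡0 c d q∈cd)) (leftOf⇒orient-pos c d a b ab-left q∈ab)
apart⇒disjoint a b c d (inj₂ (inj₂ (inj₂ ab-right))) (q∈ab , q∈cd) =
  <-irrefl (sym (onSeg⇒reverse-orient≡0 c d q∈cd)) (leftOf⇒orient-pos d c a b ab-right q∈ab)

corner-meet : ∀ a b c → orient b c a ≢ 0ℚ → OnSeg a b q → OnSeg b c q → q ≡ b
corner-meet a b c a-off-bc (t , _ , _ , refl) q∈bc = begin
  lerp a b t  ≡⟨ cong (lerp a b) t≡1 ⟩
  lerp a b 1ℚ ≡⟨ lerp-1 a b ⟩
  b           ∎
  where
  open ≡-Reasoning
  t≡1 : t ≡ 1ℚ
  t≡1 = interpolate-root a-off-bc (begin
    orient b c a + t * (0ℚ - orient b c a)           ≡⟨ cong (λ z → orient b c a + t * (z - orient b c a))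
                                                              (sym (orient[a,b,a]≡0 b c)) ⟩
    orient b c a + t * (orient b c b - orient b c a) ≡⟨ sym (orient-lerp b c a b t) ⟩
    orient b c (lerp a b t)                          ≡⟨ onSeg⇒orient≡0 b c q∈bc ⟩
    0ℚ                                               ∎)

module _ {n : ℕ.ℕ} (v : Polygon n) where

  DistinctVertices : Set
  DistinctVertices = ∀ i j → i ≢ j → v i ≢ v j

  NonAdjacentEdgesApart : Set
  NonAdjacentEdgesApart = ∀ i j → i ≢ j → next i ≢ j → next j ≢ i →
    Apart (v i) (v (next i)) (v j) (v (next j))

  NonDegenerateCorners : Set
  NonDegenerateCorners = ∀ i → orient (v (next i)) (v (next (next i))) (v i) ≢ 0ℚ

  distinctVertices? : Dec DistinctVertices
  distinctVertices? = all? λ i → all? λ j → ¬? (i ≟ j) →-dec ¬? (≡-dec _≟ℚ_ _≟ℚ_ (v i) (v j))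

  nonAdjacentEdgesApart? : Dec NonAdjacentEdgesApart
  nonAdjacentEdgesApart? = all? λ i → all? λ j →
    ¬? (i ≟ j) →-dec ¬? (next i ≟ j) →-dec ¬? (next j ≟ i) →-dec
    apart? (v i) (v (next i)) (v j) (v (next j))

  nonDegenerateCorners? : Dec NonDegenerateCorners
  nonDegenerateCorners? = all? λ i → ¬? (orient (v (next i)) (v (next (next i))) (v i) ≟ℚ 0ℚ)

  apart∧nonDegenerate⇒simple :
    DistinctVertices → NonAdjacentEdgesApart → NonDegenerateCorners → IsSimple v
  apart∧nonDegenerate⇒simple distinct apart corners =
    distinct ,
    (λ i j i≢j i↛j j↛i _ →
      apart⇒disjoint (v i) (v (next i)) (v j) (v (next j)) (apart i j i≢j i↛j j↛i)) ,
    (λ i _ → corner-meet (v i) (v (next i)) (v (next (next i))) (corners i))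

  -- Lying off every edge line is more than avoiding the boundary, but it is decided by signs alone.
  StrictlyOutside : Point → Set
  StrictlyOutside r = (∀ i → orient (v i) (v (next i)) r ≢ 0ℚ) × ¬ Odd (crossingNumber v r)

  strictlyOutside? : ∀ r → Dec (StrictlyOutside r)
  strictlyOutside? r =
    all? (λ i → ¬? (orient (v i) (v (next i)) r ≟ℚ 0ℚ)) ×-dec ¬? (crossingNumber v r ℕ.% 2 ℕ.≟ 1)

  strictlyOutside⇒∉P : StrictlyOutside r → ¬ (r ∈P v)
  strictlyOutside⇒∉P (off-edges , _) (inj₁ (i , r∈edge)) =
    orient≢0⇒¬onSeg (v i) (v (next i)) (off-edges i) r∈edge
  strictlyOutside⇒∉P (_ , even) (inj₂ odd) = even odd

  BlocksSight : Point → Point → ℚ → Set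
  BlocksSight p q t = 0ℚ ≤ t × t ≤ 1ℚ × StrictlyOutside (lerp p q t)

  blocksSight? : ∀ p q t → Dec (BlocksSight p q t)
  blocksSight? p q t = 0ℚ ≤? t ×-dec t ≤? 1ℚ ×-dec strictlyOutside? (lerp p q t)

  blocksSight⇒¬Sees : ∀ p q t → BlocksSight p q t → ¬ Sees v p q
  blocksSight⇒¬Sees p q t (0≤t , t≤1 , outside) sees = strictlyOutside⇒∉P outside (sees t 0≤t t≤1)

  unseen⇒¬Guards : ∀ {k} (g : Fin k → Point) q → q ∈P v → (∀ j → ¬ Sees v (g j) q) → ¬ Guards v g
  unseen⇒¬Guards _ q q∈P unseen guards with guards q q∈P
  ... | j , sees = unseen j sees

nonagon-simple : IsSimple nonagon
nonagon-simple = apart∧nonDegenerate⇒simple nonagon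
  (from-yes (distinctVertices? nonagon))
  (from-yes (nonAdjacentEdgesApart? nonagon))
  (from-yes (nonDegenerateCorners? nonagon))

hiddenPoint : Fin 3 → Point
hiddenPoint zero             = (+ 7 / 1 , + 15 / 4)
hiddenPoint (suc zero)       = (+ 5 / 2 , + 15 / 4)
hiddenPoint (suc (suc zero)) = (+ 1 / 1 , + 17 / 4)

blockingParameter : Fin 3 → Fin 3 → ℚ
blockingParameter zero             zero             = + 1 / 2
blockingParameter zero             (suc zero)       = + 3 / 4
blockingParameter zero             (suc (suc zero)) = + 1 / 2
blockingParameter (suc zero)       zero             = + 2 / 3
blockingParameter (suc zero)       (suc zero)       = + 1 / 2
blockingParameter (suc zero)       (suc (suc zero)) = + 1 / 2
blockingParameter (suc (suc zero)) zero             = + 1 / 2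
blockingParameter (suc (suc zero)) (suc zero)       = + 1 / 2
blockingParameter (suc (suc zero)) (suc (suc zero)) = + 4 / 5

hiddenPoint∈nonagon : ∀ s → hiddenPoint s ∈P nonagon
hiddenPoint∈nonagon zero             = inj₂ refl
hiddenPoint∈nonagon (suc zero)       = inj₂ refl
hiddenPoint∈nonagon (suc (suc zero)) = inj₂ refl

sightBlocked : ∀ s j →
  BlocksSight nonagon (nonagon (every3rd s j)) (hiddenPoint s) (blockingParameter s j)
sightBlocked = from-yes (all? λ s → all? λ j →
  blocksSight? nonagon (nonagon (every3rd s j)) (hiddenPoint s) (blockingParameter s j))

mainTheorem1 : IsSimple nonagon
    × (∀ (s : Fin 3) → ¬ Guards nonagon (λ m → nonagon (every3rd s m)))
mainTheorem1 = nonagon-simple , λ s →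
  unseen⇒¬Guards nonagon (λ m → nonagon (every3rd s m)) (hiddenPoint s) (hiddenPoint∈nonagon s)
    λ j → blocksSight⇒¬Sees nonagon (nonagon (every3rd s j)) (hiddenPoint s) (blockingParameter s j)
            (sightBlocked s j)
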